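{- For every formula $\varphi\in\mathsf L$ there exists a formula $\widetilde\varphi$ in $\bigcirc$-normal form such that $\varphi\leftrightarrow\widetilde\varphi$ is valid over the class of persistent models.
   Context: Formulas of $\mathsf L$: $p \mid \bot \mid \wedge \mid \vee \mid \to \mid \bigcirc \mid \Diamond \mid \Box \mid \mathsf U \mid \mathsf R$. A formula is in $\bigcirc$-normal form if all occurrences of $\bigcirc$ in it are within subformulas of the form $\bigcirc^i p$ with $p$ a propositional variable (i.e. $\bigcirc$ is only ever applied to a variable or to a formula $\bigcirc^j p$). A persistent model is $(W,\preccurlyeq,S,V)$ with $\preccurlyeq$ a partial order on nonempty $W$, $S\colon W\to W$ forward confluent ($w\preccurlyeq v\Rightarrow S(w)\preccurlyeq S(v)$) and backward confluent (if $v\succcurlyeq S(w)$ there is $u\succcurlyeq w$ with $S(u)=v$), and monotone $V\colon W\to\mathcal P(\mathbb P)$. Satisfaction: atoms by $V$; $\bot$ false; $\wedge,\vee$ classical; $w\models\bigcirc\varphi$ iff $S(w)\models\varphi$; $w\models\varphi\to\psi$ iff every $v\succcurlyeq w$ with $v\models\varphi$ has $v\models\psi$; $\Diamond\varphi$: some $S^k(w)\models\varphi$; $\Box\varphi$: all $S^k(w)\models\varphi$ ($k\ge0$); $\varphi\,\mathsf U\,\psi$: some $k$ with $S^k(w)\models\psi$ and $S^i(w)\models\varphi$ for $i<k$; $\varphi\,\mathsf R\,\psi$: for all $k$, $S^k(w)\models\psi$ or $S^i(w)\models\varphi$ for some $i<k$. -}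

module Defs where

open import Data.Nat using (ℕ; zero; suc; _<_)
open import Data.Empty using (⊥)
open import Data.Product using (_×_; Σ; ∃; ∃-syntax)
open import Data.Sum using (_⊎_)
open import Relation.Binary.PropositionalEquality using (_≡_)
open import Relation.Binary.Structures using (IsPartialOrder)

Var : Set
Var = ℕ

infixr 6 _∧_
infixr 5 _∨_
infixr 4 _⇒_

data Formula : Set where
  var  : Var → Formula
  ⊥'   : Formula
  _∧_  : Formula → Formula → Formula
  _∨_  : Formula → Formula → Formula
  _⇒_  : Formula → Formula → Formula
  ○    : Formula → Formula
  ◇    : Formula → Formula
  □    : Formula → Formula
  _U_  : Formula → Formula → Formula
  _R_  : Formula → Formula → Formula

_⇔_ : Formula → Formula → Formula
φ ⇔ ψ = (φ ⇒ ψ) ∧ (ψ ⇒ φ)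

data IsNextVar : Formula → Set where
  nv-var : ∀ p → IsNextVar (var p)
  nv-○   : ∀ {φ} → IsNextVar φ → IsNextVar (○ φ)

data NextNF : Formula → Set where
  nf-var : ∀ p → NextNF (var p)
  nf-⊥   : NextNF ⊥'
  nf-∧   : ∀ {φ ψ} → NextNF φ → NextNF ψ → NextNF (φ ∧ ψ)
  nf-∨   : ∀ {φ ψ} → NextNF φ → NextNF ψ → NextNF (φ ∨ ψ)
  nf-⇒   : ∀ {φ ψ} → NextNF φ → NextNF ψ → NextNF (φ ⇒ ψ)
  nf-○   : ∀ {φ} → IsNextVar φ → NextNF (○ φ)
  nf-◇   : ∀ {φ} → NextNF φ → NextNF (◇ φ)
  nf-□   : ∀ {φ} → NextNF φ → NextNF (□ φ)
  nf-U   : ∀ {φ ψ} → NextNF φ → NextNF ψ → NextNF (φ U ψ)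
  nf-R   : ∀ {φ ψ} → NextNF φ → NextNF ψ → NextNF (φ R ψ)

record PersistentModel : Set₁ where
  field
    W        : Set
    inhabited : W
    _≼_      : W → W → Set
    isPO     : IsPartialOrder _≡_ _≼_
    S        : W → W
    fwd      : ∀ {w v} → w ≼ v → S w ≼ S v
    bwd      : ∀ {w v} → S w ≼ v → ∃[ u ] (w ≼ u × S u ≡ v)
    V        : W → Var → Set
    V-mono   : ∀ {w v p} → w ≼ v → V w p → V v p

module _ (M : PersistentModel) where
  open PersistentModel M

  iter : ℕ → W → W
  iter zero w = w
  iter (suc k) w = S (iter k w)

  infix 3 _⊨_
  _⊨_ : W → Formula → Set
  w ⊨ var p = V w p
  w ⊨ ⊥' = ⊥
  w ⊨ φ ∧ ψ = (w ⊨ φ) × (w ⊨ ψ)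
  w ⊨ φ ∨ ψ = (w ⊨ φ) ⊎ (w ⊨ ψ)
  w ⊨ φ ⇒ ψ = ∀ v → w ≼ v → v ⊨ φ → v ⊨ ψ
  w ⊨ ○ φ = S w ⊨ φ
  w ⊨ ◇ φ = ∃[ k ] (iter k w ⊨ φ)
  w ⊨ □ φ = ∀ k → iter k w ⊨ φ
  w ⊨ φ U ψ = ∃[ k ] ((iter k w ⊨ ψ) × (∀ i → i < k → iter i w ⊨ φ))
  w ⊨ φ R ψ = ∀ k → (iter k w ⊨ ψ) ⊎ (∃[ i ] (i < k × iter i w ⊨ φ))

Valid : Formula → Set₁
Valid φ = (M : PersistentModel) → (w : PersistentModel.W M) → _⊨_ M w φ

-- Pushing ○ through a formula only needs two facts. The temporal operators
-- commute with ○ because S^k ∘ S = S ∘ S^k. For implication,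
-- ○ (φ ⇒ ψ) ↔ (○ φ ⇒ ○ ψ) holds exactly because S is forward and backward
-- confluent: the worlds above S w are precisely the S-images of worlds above w.
module Submission where

open import Defs
open import Data.Nat using (ℕ; zero; suc; _<_)
open import Data.Product using (Σ; _×_; _,_; ∃; ∃-syntax; map₂)
open import Data.Product.Function.NonDependent.Propositional using (_×-⇔_)
open import Data.Sum using (_⊎_)
import Data.Sum as Sum
open import Data.Sum.Function.Propositional using (_⊎-⇔_)
open import Function.Bundles using (Equivalence; mk⇔) renaming (_⇔_ to _⇔ˢ_)
import Function.Properties.Equivalence as ⇔
open import Function.Base using (_∘_)
open import Relation.Binary.PropositionalEquality using (_≡_; refl; cong)

open Equivalence using (to; from)

pushNext : Formula → Formula
pushNext (var p) = ○ (var p)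
pushNext ⊥'      = ⊥'
pushNext (φ ∧ ψ) = pushNext φ ∧ pushNext ψ
pushNext (φ ∨ ψ) = pushNext φ ∨ pushNext ψ
pushNext (φ ⇒ ψ) = pushNext φ ⇒ pushNext ψ
pushNext (○ φ)   = ○ (○ φ)
pushNext (◇ φ)   = ◇ (pushNext φ)
pushNext (□ φ)   = □ (pushNext φ)
pushNext (φ U ψ) = pushNext φ U pushNext ψ
pushNext (φ R ψ) = pushNext φ R pushNext ψ

normalise : Formula → Formula
normalise (var p) = var p
normalise ⊥'      = ⊥'
normalise (φ ∧ ψ) = normalise φ ∧ normalise ψ
normalise (φ ∨ ψ) = normalise φ ∨ normalise ψ
normalise (φ ⇒ ψ) = normalise φ ⇒ normalise ψ
normalise (○ φ)   = pushNext (normalise φ)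
normalise (◇ φ)   = ◇ (normalise φ)
normalise (□ φ)   = □ (normalise φ)
normalise (φ U ψ) = normalise φ U normalise ψ
normalise (φ R ψ) = normalise φ R normalise ψ

pushNext-nextNF : ∀ {φ} → NextNF φ → NextNF (pushNext φ)
pushNext-nextNF (nf-var p) = nf-○ (nv-var p)
pushNext-nextNF nf-⊥       = nf-⊥
pushNext-nextNF (nf-∧ n m) = nf-∧ (pushNext-nextNF n) (pushNext-nextNF m)
pushNext-nextNF (nf-∨ n m) = nf-∨ (pushNext-nextNF n) (pushNext-nextNF m)
pushNext-nextNF (nf-⇒ n m) = nf-⇒ (pushNext-nextNF n) (pushNext-nextNF m)
pushNext-nextNF (nf-○ v)   = nf-○ (nv-○ v)
pushNext-nextNF (nf-◇ n)   = nf-◇ (pushNext-nextNF n)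
pushNext-nextNF (nf-□ n)   = nf-□ (pushNext-nextNF n)
pushNext-nextNF (nf-U n m) = nf-U (pushNext-nextNF n) (pushNext-nextNF m)
pushNext-nextNF (nf-R n m) = nf-R (pushNext-nextNF n) (pushNext-nextNF m)

normalise-nextNF : ∀ φ → NextNF (normalise φ)
normalise-nextNF (var p) = nf-var p
normalise-nextNF ⊥'      = nf-⊥
normalise-nextNF (φ ∧ ψ) = nf-∧ (normalise-nextNF φ) (normalise-nextNF ψ)
normalise-nextNF (φ ∨ ψ) = nf-∨ (normalise-nextNF φ) (normalise-nextNF ψ)
normalise-nextNF (φ ⇒ ψ) = nf-⇒ (normalise-nextNF φ) (normalise-nextNF ψ)
normalise-nextNF (○ φ)   = pushNext-nextNF (normalise-nextNF φ)
normalise-nextNF (◇ φ)   = nf-◇ (normalise-nextNF φ)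
normalise-nextNF (□ φ)   = nf-□ (normalise-nextNF φ)
normalise-nextNF (φ U ψ) = nf-U (normalise-nextNF φ) (normalise-nextNF ψ)
normalise-nextNF (φ R ψ) = nf-R (normalise-nextNF φ) (normalise-nextNF ψ)

Until : (ℕ → Set) → (ℕ → Set) → Set
Until P Q = ∃[ k ] (Q k × ∀ i → i < k → P i)

Release : (ℕ → Set) → (ℕ → Set) → Set
Release P Q = ∀ k → Q k ⊎ ∃[ i ] (i < k × P i)

module _ {P P′ : ℕ → Set} (P⇔P′ : ∀ k → P k ⇔ˢ P′ k) where

  ∃-cong-⇔ : ∃ P ⇔ˢ ∃ P′
  ∃-cong-⇔ = mk⇔ (map₂ λ {k} → to (P⇔P′ k)) (map₂ λ {k} → from (P⇔P′ k))

  ∀-cong-⇔ : (∀ k → P k) ⇔ˢ (∀ k → P′ k)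
  ∀-cong-⇔ = mk⇔ (λ h k → to (P⇔P′ k) (h k)) (λ h k → from (P⇔P′ k) (h k))

module _ {P P′ Q Q′ : ℕ → Set} (P⇔P′ : ∀ k → P k ⇔ˢ P′ k) (Q⇔Q′ : ∀ k → Q k ⇔ˢ Q′ k) where

  Until-cong-⇔ : Until P Q ⇔ˢ Until P′ Q′
  Until-cong-⇔ = mk⇔
    (λ (k , Qk , P<k) → k , to (Q⇔Q′ k) Qk , λ i i<k → to (P⇔P′ i) (P<k i i<k))
    (λ (k , Qk , P<k) → k , from (Q⇔Q′ k) Qk , λ i i<k → from (P⇔P′ i) (P<k i i<k))

  Release-cong-⇔ : Release P Q ⇔ˢ Release P′ Q′
  Release-cong-⇔ = mk⇔
    (λ h k → Sum.map (to (Q⇔Q′ k)) (map₂ λ {i} → map₂ (to (P⇔P′ i))) (h k))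
    (λ h k → Sum.map (from (Q⇔Q′ k)) (map₂ λ {i} → map₂ (from (P⇔P′ i))) (h k))

module SemanticEquivalence (M : PersistentModel) where
  open PersistentModel M

  infix 3 _⊨ₘ_
  _⊨ₘ_ : W → Formula → Set
  _⊨ₘ_ = _⊨_ M

  infix 2 _≈_
  record _≈_ (φ ψ : Formula) : Set where
    constructor pointwise
    field at : ∀ w → (w ⊨ₘ φ) ⇔ˢ (w ⊨ₘ ψ)
  open _≈_

  ≈-trans : ∀ {φ ψ χ} → φ ≈ ψ → ψ ≈ χ → φ ≈ χ
  ≈-trans e f = pointwise λ w → ⇔.trans (at e w) (at f w)

  iter-S : ∀ k w → iter M k (S w) ≡ S (iter M k w)
  iter-S zero    w = refl
  iter-S (suc k) w = cong S (iter-S k w)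

  ○-shift : ∀ {φ ψ} → ○ φ ≈ ψ → ∀ w k → (iter M k (S w) ⊨ₘ φ) ⇔ˢ (iter M k w ⊨ₘ ψ)
  ○-shift e w k rewrite iter-S k w = at e (iter M k w)

  ○-⇒ : ∀ φ ψ → ○ (φ ⇒ ψ) ≈ ○ φ ⇒ ○ ψ
  ○-⇒ φ ψ = pointwise λ w → mk⇔ (λ h u w≼u → h (S u) (fwd w≼u)) (pull w)
    where
      pull : ∀ w → w ⊨ₘ ○ φ ⇒ ○ ψ → w ⊨ₘ ○ (φ ⇒ ψ)
      pull w h v Sw≼v with bwd Sw≼v
      ... | u , w≼u , refl = h u w≼u

  ○-cong : ∀ {φ ψ} → φ ≈ ψ → ○ φ ≈ ○ ψ
  ○-cong e = pointwise λ w → at e (S w)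

  ∧-cong : ∀ {φ φ′ ψ ψ′} → φ ≈ φ′ → ψ ≈ ψ′ → φ ∧ ψ ≈ φ′ ∧ ψ′
  ∧-cong eφ eψ = pointwise λ w → at eφ w ×-⇔ at eψ w

  ∨-cong : ∀ {φ φ′ ψ ψ′} → φ ≈ φ′ → ψ ≈ ψ′ → φ ∨ ψ ≈ φ′ ∨ ψ′
  ∨-cong eφ eψ = pointwise λ w → at eφ w ⊎-⇔ at eψ w

  ⇒-cong : ∀ {φ φ′ ψ ψ′} → φ ≈ φ′ → ψ ≈ ψ′ → φ ⇒ ψ ≈ φ′ ⇒ ψ′
  ⇒-cong eφ eψ = pointwise λ w → mk⇔
    (λ h v w≼v → to (at eψ v) ∘ h v w≼v ∘ from (at eφ v))
    (λ h v w≼v → from (at eψ v) ∘ h v w≼v ∘ to (at eφ v))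

  ◇-cong : ∀ {φ ψ} → φ ≈ ψ → ◇ φ ≈ ◇ ψ
  ◇-cong e = pointwise λ w → ∃-cong-⇔ (λ k → at e (iter M k w))

  □-cong : ∀ {φ ψ} → φ ≈ ψ → □ φ ≈ □ ψ
  □-cong e = pointwise λ w → ∀-cong-⇔ (λ k → at e (iter M k w))

  U-cong : ∀ {φ φ′ ψ ψ′} → φ ≈ φ′ → ψ ≈ ψ′ → φ U ψ ≈ φ′ U ψ′
  U-cong eφ eψ = pointwise λ w →
    Until-cong-⇔ (λ k → at eφ (iter M k w)) (λ k → at eψ (iter M k w))

  R-cong : ∀ {φ φ′ ψ ψ′} → φ ≈ φ′ → ψ ≈ ψ′ → φ R ψ ≈ φ′ R ψ′
  R-cong eφ eψ = pointwise λ w →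
    Release-cong-⇔ (λ k → at eφ (iter M k w)) (λ k → at eψ (iter M k w))

  ○≈pushNext : ∀ φ → ○ φ ≈ pushNext φ
  ○≈pushNext (var p) = pointwise λ _ → ⇔.refl
  ○≈pushNext ⊥'      = pointwise λ _ → ⇔.refl
  ○≈pushNext (φ ∧ ψ) = pointwise λ w → at (○≈pushNext φ) w ×-⇔ at (○≈pushNext ψ) w
  ○≈pushNext (φ ∨ ψ) = pointwise λ w → at (○≈pushNext φ) w ⊎-⇔ at (○≈pushNext ψ) w
  ○≈pushNext (φ ⇒ ψ) = ≈-trans (○-⇒ φ ψ) (⇒-cong (○≈pushNext φ) (○≈pushNext ψ))
  ○≈pushNext (○ φ)   = pointwise λ _ → ⇔.refl
  ○≈pushNext (◇ φ)   = pointwise λ w → ∃-cong-⇔ (○-shift (○≈pushNext φ) w)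
  ○≈pushNext (□ φ)   = pointwise λ w → ∀-cong-⇔ (○-shift (○≈pushNext φ) w)
  ○≈pushNext (φ U ψ) = pointwise λ w →
    Until-cong-⇔ (○-shift (○≈pushNext φ) w) (○-shift (○≈pushNext ψ) w)
  ○≈pushNext (φ R ψ) = pointwise λ w →
    Release-cong-⇔ (○-shift (○≈pushNext φ) w) (○-shift (○≈pushNext ψ) w)

  ≈normalise : ∀ φ → φ ≈ normalise φ
  ≈normalise (var p) = pointwise λ _ → ⇔.refl
  ≈normalise ⊥'      = pointwise λ _ → ⇔.refl
  ≈normalise (φ ∧ ψ) = ∧-cong (≈normalise φ) (≈normalise ψ)
  ≈normalise (φ ∨ ψ) = ∨-cong (≈normalise φ) (≈normalise ψ)
  ≈normalise (φ ⇒ ψ) = ⇒-cong (≈normalise φ) (≈normalise ψ)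
  ≈normalise (○ φ)   = ≈-trans (○-cong (≈normalise φ)) (○≈pushNext (normalise φ))
  ≈normalise (◇ φ)   = ◇-cong (≈normalise φ)
  ≈normalise (□ φ)   = □-cong (≈normalise φ)
  ≈normalise (φ U ψ) = U-cong (≈normalise φ) (≈normalise ψ)
  ≈normalise (φ R ψ) = R-cong (≈normalise φ) (≈normalise ψ)

  ≈⇒⊨⇔ : ∀ {φ ψ} → φ ≈ ψ → ∀ w → w ⊨ₘ φ ⇔ ψ
  ≈⇒⊨⇔ e w = (λ v _ → to (at e v)) , (λ v _ → from (at e v))

theorem4p2 : (φ : Formula) → Σ Formula (λ φ̃ → NextNF φ̃ × Valid (φ ⇔ φ̃))
theorem4p2 φ = normalise φ , normalise-nextNF φ ,
  λ M → SemanticEquivalence.≈⇒⊨⇔ M (SemanticEquivalence.≈normalise M φ)
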